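{- Let $k\ge 0$ be an integer. If $F$ is a forest of order $n$, then $\alpha_k(F)\geq \left\lceil\dfrac{k+1}{k+2}\,n\right\rceil$.
   Context: All graphs are finite and simple. A set $S$ of vertices of a graph $G$ is $k$-sparse if the subgraph induced by $S$ has maximum degree at most $k$. $\alpha_k(G)$ denotes the maximum size of a $k$-sparse set of $G$. A forest is a graph with no cycles. -}

module Defs where

open import Data.Nat using (ℕ; suc; _+_; _∸_; _≤_; NonZero)
open import Data.Nat.DivMod using (_/_)
open import Data.Bool using (Bool; true; false; if_then_else_)
open import Data.Fin using (Fin)
open import Data.Fin.Subset using (Subset; _∈_; _∩_; ∣_∣; inside; outside)
open import Data.Vec using (tabulate)
open import Data.List using (List; []; _∷_; length; last)
open import Data.List.Relation.Unary.Unique.Propositional using (Unique)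
open import Data.Maybe using (just)
open import Data.Product using (Σ; _×_)
open import Relation.Binary.PropositionalEquality using (_≡_)
open import Relation.Nullary using (¬_)
open import Data.Unit using (⊤)

record Graph (n : ℕ) : Set where
  field
    adj    : Fin n → Fin n → Bool
    sym    : ∀ u v → adj u v ≡ adj v u
    irrefl : ∀ v → adj v v ≡ false
open Graph public

N : ∀ {n} → Graph n → Fin n → Subset n
N G v = tabulate (λ u → if adj G v u then inside else outside)

degIn : ∀ {n} → Graph n → Subset n → Fin n → ℕ
degIn G S v = ∣ S ∩ N G v ∣

Sparse : ∀ {n} → ℕ → Graph n → Subset n → Set
Sparse k G S = ∀ v → v ∈ S → degIn G S v ≤ k

IsWalk : ∀ {n} → Graph n → List (Fin n) → Set
IsWalk G []           = ⊤
IsWalk G (v ∷ [])     = ⊤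
IsWalk G (u ∷ v ∷ vs) = (adj G u v ≡ true) × IsWalk G (v ∷ vs)

-- A cycle: distinct vertices v₀ … v_{m-1}, m ≥ 3, with v_i ~ v_{i+1}
-- and v_{m-1} ~ v₀.
record Cycle {n} (G : Graph n) : Set where
  field
    v₀     : Fin n
    rest   : List (Fin n)
    len    : 2 ≤ length rest
    distinct : Unique (v₀ ∷ rest)
    walk   : IsWalk G (v₀ ∷ rest)
    closes : Σ (Fin n) (λ w → (last rest ≡ just w) × (adj G w v₀ ≡ true))

Forest : ∀ {n} → Graph n → Set
Forest G = ¬ Cycle G

⌈_/_⌉ : ℕ → (b : ℕ) → .{{NonZero b}} → ℕ
⌈ a / b ⌉ = (a + b ∸ 1) / b

-- Vertices are decided one at a time, always at an undecided vertex u with at most one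
-- undecided neighbour; such a u exists because a vertex set in which every vertex has two
-- neighbours inside the set contains a cycle. Each undecided vertex w carries a credit that
-- bounds its number of selected neighbours and exceeds k if one of them already has k
-- selected neighbours. If credit u ≤ k then u is selected, which keeps the selection
-- k-sparse, and its credit plus one passes to its undecided neighbour; otherwise u is
-- excluded. Selecting raises the total credit by at most one and excluding frees at least
-- k + 1, so (k + 1)|X| + Σ credit ≤ |S| holds throughout; at the end |S| + |X| = n, whence
-- (k + 2)|S| ≥ (k + 1)n.

module Submission where

open import Defs hiding (sym)
open import Data.Nat
open import Data.Nat.Properties
open import Data.Nat.DivMod using (_/_; m<n*o⇒m/o<n)
open import Data.Bool using (Bool; true; false; _∧_; if_then_else_)
open import Data.Bool.Properties using (∧-identityʳ; ∧-conicalˡ; ∧-conicalʳ) renaming (_≟_ to _≟ᵇ_)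
open import Data.Fin using (Fin; zero; suc; punchIn; punchOut) renaming (_<_ to _<ᶠ_)
open import Data.Fin.Properties using (punchInᵢ≢i; pigeonhole; any?) renaming (_≟_ to _≟ᶠ_)
open import Data.Fin.Subset using (Subset; ∣_∣; _∩_; _∈_)
open import Data.List using (List; []; _∷_; length; last; lookup)
open import Data.List.Membership.Propositional using () renaming (_∈_ to _∈ˡ_)
open import Data.List.Membership.Propositional.Properties using (∈-lookup)
import Data.List.Membership.DecPropositional as DecMembership
open import Data.List.Relation.Unary.All as All using (All; []; _∷_)
open import Data.List.Relation.Unary.All.Properties using (¬Any⇒All¬)
open import Data.List.Relation.Unary.Any using (here; there)
open import Data.List.Relation.Unary.AllPairs using ([]; _∷_)
open import Data.List.Relation.Unary.Unique.Propositional using (Unique)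
open import Data.Maybe using (just)
open import Data.Product using (Σ; ∃; ∃₂; _×_; _,_)
open import Data.Unit using (tt)
open import Data.Vec using (tabulate; _∷_)
open import Data.Vec.Properties using ([]=⇒lookup; lookup∘tabulate)
open import Data.Vec.Functional using (removeAt; updateAt)
open import Data.Vec.Functional.Properties using (removeAt-punchOut; updateAt-updates; updateAt-minimal)
open import Function using (_∘_)
open import Relation.Binary.Definitions using (DecidableEquality)
open import Relation.Binary.PropositionalEquality
open import Relation.Nullary using (yes; no; does)
open import Relation.Nullary.Decidable using (_×-dec_; dec-true; dec-false)
open import Relation.Nullary.Negation using (contradiction)
open import Algebra.Properties.CommutativeMonoid.Sum +-0-commutativeMonoid
  using (sum; sum-cong-≗; sum-remove; ∑-distrib-+)
open import Algebra.Properties.Semiring.Sum +-*-semiring using (*-distribˡ-sum)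

-- Counting over Fin n

boolToℕ : Bool → ℕ
boolToℕ false = 0
boolToℕ true  = 1

count : ∀ {n} → (Fin n → Bool) → ℕ
count P = sum (boolToℕ ∘ P)

sum-exchangeAt : ∀ {n} (f g : Fin n → ℕ) u → (∀ i → i ≢ u → f i ≡ g i) →
                 sum f + g u ≡ sum g + f u
sum-exchangeAt {suc n} f g u f≡g = begin
  sum f + g u                               ≡⟨ cong (_+ g u) (sum-remove f) ⟩
  f u + sum (removeAt f u) + g u            ≡⟨ cong (λ s → f u + s + g u) rest ⟩
  f u + sum (removeAt g u) + g u            ≡⟨ +-assoc (f u) _ (g u) ⟩
  f u + (sum (removeAt g u) + g u)          ≡⟨ +-comm (f u) _ ⟩
  sum (removeAt g u) + g u + f u            ≡⟨ cong (_+ f u) (+-comm _ (g u)) ⟩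
  g u + sum (removeAt g u) + f u            ≡⟨ cong (_+ f u) (sum-remove g) ⟨
  sum g + f u                               ∎
  where
  open ≡-Reasoning
  rest : sum (removeAt f u) ≡ sum (removeAt g u)
  rest = sum-cong-≗ (λ j → f≡g (punchIn u j) (punchInᵢ≢i u j))

count-exchangeAt : ∀ {n} (P Q : Fin n → Bool) u → (∀ i → i ≢ u → P i ≡ Q i) →
                   count P + boolToℕ (Q u) ≡ count Q + boolToℕ (P u)
count-exchangeAt P Q u P≡Q = sum-exchangeAt _ _ u (λ i i≢u → cong boolToℕ (P≡Q i i≢u))

count-cong : ∀ {n} {P Q : Fin n → Bool} → (∀ i → P i ≡ Q i) → count P ≡ count Q
count-cong P≡Q = sum-cong-≗ (cong boolToℕ ∘ P≡Q)

zeroAt : ∀ {n} → (Fin n → ℕ) → Fin n → Fin n → ℕ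
zeroAt f u = updateAt f u (λ _ → 0)

sum-zeroAt : ∀ {n} (f : Fin n → ℕ) u → sum (zeroAt f u) + f u ≡ sum f
sum-zeroAt f u = trans (sum-exchangeAt _ f u (λ i i≢u → updateAt-minimal i u f i≢u))
                       (trans (cong (sum f +_) (updateAt-updates u f)) (+-identityʳ _))

count-true : ∀ {n} → count {n} (λ _ → true) ≡ n
count-true {zero}  = refl
count-true {suc n} = cong suc count-true

count-false : ∀ {n} → count {n} (λ _ → false) ≡ 0
count-false {zero}  = refl
count-false {suc n} = count-false {n}

count>0⇒∃ : ∀ {n} (P : Fin n → Bool) → 0 < count P → ∃ λ i → P i ≡ true
count>0⇒∃ {suc n} P 0<c with P zero in eq
... | true  = zero , eq
... | false with count>0⇒∃ (P ∘ suc) 0<c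
...   | i , Pi = suc i , Pi

∃⇒count>0 : ∀ {n} (P : Fin n → Bool) {i} → P i ≡ true → 0 < count P
∃⇒count>0 {suc n} P {i} Pi rewrite sum-remove {i = i} (boolToℕ ∘ P) | Pi = s≤s z≤n

count≥2⇒other : ∀ {n} (P : Fin n → Bool) → 2 ≤ count P → ∀ x → ∃ λ y → P y ≡ true × y ≢ x
count≥2⇒other {suc n} P 2≤c x =
  let j , Pj = count>0⇒∃ (removeAt P x) (rest-pos (P x) (subst (2 ≤_) (sum-remove (boolToℕ ∘ P)) 2≤c))
  in punchIn x j , Pj , punchInᵢ≢i x j
  where
  rest-pos : ∀ b {c} → 2 ≤ boolToℕ b + c → 0 < c
  rest-pos false 2≤c = <-trans z<s 2≤c
  rest-pos true  2≤c = s≤s⁻¹ 2≤c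

count≤1⇒unique : ∀ {n} (P : Fin n → Bool) → count P ≤ 1 → ∀ {a b} → P a ≡ true → P b ≡ true → a ≡ b
count≤1⇒unique {suc n} P c≤1 {a} {b} Pa Pb with a ≟ᶠ b
... | yes a≡b = a≡b
... | no  a≢b = contradiction c≤1 (<⇒≱ (begin-strict
  1                                   <⟨ s≤s (∃⇒count>0 (removeAt P a) Pb′) ⟩
  1 + count (removeAt P a)            ≡⟨ cong (λ t → boolToℕ t + count (removeAt P a)) Pa ⟨
  boolToℕ (P a) + count (removeAt P a) ≡⟨ sum-remove (boolToℕ ∘ P) ⟨
  count P                             ∎))
  where
  open ≤-Reasoning
  Pb′ : removeAt P a (punchOut a≢b) ≡ true
  Pb′ = trans (removeAt-punchOut P a≢b) Pb

∣tabulate∣≡count : ∀ {n} (P : Fin n → Bool) → ∣ tabulate P ∣ ≡ count P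
∣tabulate∣≡count {zero}  P = refl
∣tabulate∣≡count {suc n} P with P zero
... | true  = cong suc (∣tabulate∣≡count (P ∘ suc))
... | false = ∣tabulate∣≡count (P ∘ suc)

tabulate-∩ : ∀ {n} (P Q : Fin n → Bool) → tabulate P ∩ tabulate Q ≡ tabulate (λ i → P i ∧ Q i)
tabulate-∩ {zero}  P Q = refl
tabulate-∩ {suc n} P Q = cong (P zero ∧ Q zero ∷_) (tabulate-∩ (P ∘ suc) (Q ∘ suc))

-- Paths and cycles

private
  variable
    A : Set
    x : A
    xs : List A

lookup-unique : Unique xs → ∀ {i j} → i <ᶠ j → lookup xs i ≢ lookup xs j
lookup-unique (x∉ ∷ _) {zero}  {suc j} _         = All.lookup x∉ (∈-lookup j)
lookup-unique (_ ∷ u)  {suc i} {suc j} (s≤s i<j) = lookup-unique u i<j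

unique⇒length≤ : ∀ {n} {xs : List (Fin n)} → Unique xs → length xs ≤ n
unique⇒length≤ {n} {xs} u with length xs ≤? n
... | yes ≤n = ≤n
... | no  ≰n with i , j , i<j , eq ← pigeonhole (≰⇒> ≰n) (lookup xs) = contradiction eq (lookup-unique u i<j)

takeThrough : (xs : List A) → x ∈ˡ xs → List A
takeThrough (x ∷ _)  (here _)  = x ∷ []
takeThrough (x ∷ xs) (there m) = x ∷ takeThrough xs m

takeThrough-nonEmpty : ∀ xs (m : x ∈ˡ xs) → 1 ≤ length (takeThrough xs m)
takeThrough-nonEmpty (_ ∷ _) (here _)  = s≤s z≤n
takeThrough-nonEmpty (_ ∷ _) (there _) = s≤s z≤n

last-takeThrough : ∀ xs (m : x ∈ˡ xs) → last (takeThrough xs m) ≡ just x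
last-takeThrough (_ ∷ _)      (here refl)       = refl
last-takeThrough (_ ∷ y ∷ ys) (there (here refl)) = refl
last-takeThrough (_ ∷ y ∷ ys) (there (there m))  = last-takeThrough (y ∷ ys) (there m)

All-takeThrough : ∀ {P : A → Set} xs (m : x ∈ˡ xs) → All P xs → All P (takeThrough xs m)
All-takeThrough (_ ∷ _)  (here _)  (px ∷ _)   = px ∷ []
All-takeThrough (_ ∷ xs) (there m) (px ∷ pxs) = px ∷ All-takeThrough xs m pxs

Unique-takeThrough : ∀ xs (m : x ∈ˡ xs) → Unique xs → Unique (takeThrough xs m)
Unique-takeThrough (_ ∷ _)  (here _)  _          = [] ∷ []
Unique-takeThrough (_ ∷ xs) (there m) (x∉ ∷ u)   = All-takeThrough xs m x∉ ∷ Unique-takeThrough xs m u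

module _ {n} (G : Graph n) where

  open DecMembership (_≟ᶠ_ {n}) using (_∈?_)

  IsWalk-takeThrough : ∀ xs (m : x ∈ˡ xs) → IsWalk G xs → IsWalk G (takeThrough xs m)
  IsWalk-takeThrough (_ ∷ _)      (here _)            _       = tt
  IsWalk-takeThrough (_ ∷ _ ∷ _)  (there (here _))    (e , _) = e , tt
  IsWalk-takeThrough (_ ∷ y ∷ ys) (there (there m))   (e , w) = e , IsWalk-takeThrough (y ∷ ys) (there m) w

  adj⇒≢ : ∀ {u v} → adj G u v ≡ true → u ≢ v
  adj⇒≢ {u} uv refl = contradiction (trans (sym uv) (irrefl G u)) λ ()

  module _ (B : Fin n → Bool)
           (branching : ∀ {u} → B u ≡ true → ∀ x → ∃ λ y → (B y ∧ adj G u y) ≡ true × y ≢ x) where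

    -- A walk that never steps back must revisit a vertex within n steps; the
    -- first revisit closes a cycle.
    extendPath : ∀ fuel cur prev rest → B cur ≡ true →
                 Unique (cur ∷ prev ∷ rest) → IsWalk G (cur ∷ prev ∷ rest) →
                 n < length rest + 2 + fuel → Cycle G
    extendPath zero cur prev rest _ u _ n<
      = contradiction (unique⇒length≤ u) (<⇒≱ (subst (n <_) (trans (+-identityʳ _) (+-comm _ 2)) n<))
    extendPath (suc fuel) cur prev rest Bcur u w n<
      with y , By∧cy , y≢prev ← branching Bcur prev
         | y ∈? (cur ∷ prev ∷ rest)
    ... | yes (here y≡cur)           = contradiction (sym y≡cur) (adj⇒≢ (∧-conicalʳ _ _ By∧cy))
    ... | yes (there (here y≡prev))  = contradiction y≡prev y≢prev
    ... | yes (there (there y∈rest)) = record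
      { v₀       = cur
      ; rest     = prev ∷ takeThrough rest y∈rest
      ; len      = s≤s (takeThrough-nonEmpty rest y∈rest)
      ; distinct = Unique-takeThrough (cur ∷ prev ∷ rest) (there (there y∈rest)) u
      ; walk     = IsWalk-takeThrough (cur ∷ prev ∷ rest) (there (there y∈rest)) w
      ; closes   = y , last-takeThrough (prev ∷ rest) (there y∈rest)
                     , trans (Graph.sym G y cur) (∧-conicalʳ _ _ By∧cy)
      }
    ... | no y∉path = extendPath fuel y cur (prev ∷ rest) (∧-conicalˡ _ _ By∧cy)
                        (¬Any⇒All¬ _ y∉path ∷ u)
                        (trans (Graph.sym G y cur) (∧-conicalʳ _ _ By∧cy) , w)
                        (subst (n <_) (+-suc _ fuel) n<)

  minDegree≥2⇒Cycle : (B : Fin n → Bool) →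
                      (∀ {u} → B u ≡ true → 2 ≤ count (λ w → B w ∧ adj G u w)) →
                      ∀ {u} → B u ≡ true → Cycle G
  minDegree≥2⇒Cycle B deg≥2 {u₀} Bu₀
    with u₁ , Bu₁∧a₀₁ , _ ← count≥2⇒other _ (deg≥2 Bu₀) u₀
    = extendPath B (λ Bu → count≥2⇒other _ (deg≥2 Bu)) n u₁ u₀ []
        (∧-conicalˡ _ _ Bu₁∧a₀₁) (((adj⇒≢ a₀₁ ∘ sym) ∷ []) ∷ [] ∷ [])
        (trans (Graph.sym G u₁ u₀) a₀₁ , tt) (n≤1+n (suc n))
    where
    a₀₁ = ∧-conicalʳ _ _ Bu₁∧a₀₁

  forest⇒leaf : Forest G → (B : Fin n → Bool) → ∀ {u} → B u ≡ true →
                ∃ λ v → B v ≡ true × count (λ w → B w ∧ adj G v w) ≤ 1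
  forest⇒leaf forest B Bu with any? (λ v → (B v ≟ᵇ true) ×-dec (count (λ w → B w ∧ adj G v w) ≤? 1))
  ... | yes leaf = leaf
  ... | no ¬leaf = contradiction (minDegree≥2⇒Cycle B deg≥2 Bu) forest
    where
    deg≥2 : ∀ {v} → B v ≡ true → 2 ≤ count (λ w → B w ∧ adj G v w)
    deg≥2 {v} Bv = ≰⇒> (λ ≤1 → ¬leaf (v , Bv , ≤1))

-- The greedy selection

data Status : Set where
  undecided selected excluded : Status

_≟ₛ_ : DecidableEquality Status
undecided ≟ₛ undecided = yes refl
undecided ≟ₛ selected  = no λ ()
undecided ≟ₛ excluded  = no λ ()
selected  ≟ₛ undecided = no λ ()
selected  ≟ₛ selected  = yes refl
selected  ≟ₛ excluded  = no λ ()
excluded  ≟ₛ undecided = no λ ()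
excluded  ≟ₛ selected  = no λ ()
excluded  ≟ₛ excluded  = yes refl

≟ₛ-true : ∀ {s t} → does (s ≟ₛ t) ≡ true → s ≡ t
≟ₛ-true {s} {t} eq with s ≟ₛ t
... | yes s≡t = s≡t

+-boolToℕ-∧-false : ∀ m {b c} → b ≡ false → m + boolToℕ (b ∧ c) ≡ m
+-boolToℕ-∧-false m refl = +-identityʳ m

+-boolToℕ-∧-true : ∀ m {b c} → b ≡ true → m + boolToℕ (b ∧ c) ≡ m + boolToℕ c
+-boolToℕ-∧-true m refl = refl

hasStatus : ∀ {n} → (Fin n → Status) → Status → Fin n → Bool
hasStatus σ s w = does (σ w ≟ₛ s)

countIn : ∀ {n} → (Fin n → Bool) → (Fin n → Status) → Status → ℕ
countIn A σ s = count (λ w → hasStatus σ s w ∧ A w)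

assign : ∀ {n} → (Fin n → Status) → Fin n → Status → Fin n → Status
assign σ u s = updateAt σ u (λ _ → s)

module Assign {n} (σ : Fin n → Status) (u : Fin n) (s : Status) (σu : σ u ≡ undecided) where

  assign-at : assign σ u s u ≡ s
  assign-at = updateAt-updates u σ

  assign-other : ∀ {v} → v ≢ u → assign σ u s v ≡ σ v
  assign-other {v} v≢u = updateAt-minimal v u σ v≢u


  countIn-assign : ∀ A t → countIn A (assign σ u s) t + boolToℕ (does (undecided ≟ₛ t) ∧ A u)
                           ≡ countIn A σ t + boolToℕ (does (s ≟ₛ t) ∧ A u)
  countIn-assign A t = begin
    countIn A (assign σ u s) t + boolToℕ (does (undecided ≟ₛ t) ∧ A u)
      ≡⟨ cong (λ r → countIn A (assign σ u s) t + boolToℕ (does (r ≟ₛ t) ∧ A u)) σu ⟨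
    countIn A (assign σ u s) t + boolToℕ (does (σ u ≟ₛ t) ∧ A u)
      ≡⟨ count-exchangeAt _ _ u (λ w w≢u → cong (λ r → does (r ≟ₛ t) ∧ A w) (assign-other w≢u)) ⟩
    countIn A σ t + boolToℕ (does (assign σ u s u ≟ₛ t) ∧ A u)
      ≡⟨ cong (λ r → countIn A σ t + boolToℕ (does (r ≟ₛ t) ∧ A u)) assign-at ⟩
    countIn A σ t + boolToℕ (does (s ≟ₛ t) ∧ A u)
      ∎
    where open ≡-Reasoning

  module _ (s≢undecided : s ≢ undecided) where

    countIn-assign-same : ∀ A → countIn A (assign σ u s) s ≡ countIn A σ s + boolToℕ (A u)
    countIn-assign-same A =
      trans (sym (+-boolToℕ-∧-false _ (dec-false (undecided ≟ₛ s) (s≢undecided ∘ sym))))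
            (trans (countIn-assign A s) (+-boolToℕ-∧-true _ (dec-true (s ≟ₛ s) refl)))

    countIn-assign-other : ∀ A {t} → t ≢ s → t ≢ undecided → countIn A (assign σ u s) t ≡ countIn A σ t
    countIn-assign-other A {t} t≢s t≢undecided =
      trans (sym (+-boolToℕ-∧-false _ (dec-false (undecided ≟ₛ t) (t≢undecided ∘ sym))))
            (trans (countIn-assign A t) (+-boolToℕ-∧-false _ (dec-false (s ≟ₛ t) (t≢s ∘ sym))))

    countIn-assign-undecided : ∀ A → countIn A (assign σ u s) undecided + boolToℕ (A u) ≡ countIn A σ undecided
    countIn-assign-undecided A =
      trans (countIn-assign A undecided) (+-boolToℕ-∧-false _ (dec-false (s ≟ₛ undecided) s≢undecided))

    countIn-assign-undecided-≤ : ∀ A → countIn A (assign σ u s) undecided ≤ countIn A σ undecided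
    countIn-assign-undecided-≤ A =
      subst (countIn A (assign σ u s) undecided ≤_) (countIn-assign-undecided A) (m≤m+n _ _)

    assign-preserves : ∀ {v t} → assign σ u s v ≡ t → t ≢ s → σ v ≡ t × v ≢ u
    assign-preserves {v} σ′v t≢s with v ≟ᶠ u
    ... | yes refl = contradiction (trans (sym σ′v) assign-at) t≢s
    ... | no  v≢u  = trans (sym (assign-other v≢u)) σ′v , v≢u

budget-exclude : ∀ k {X T T₀ c S} → suc k * X + T ≤ S → T₀ + c ≡ T → suc k ≤ c →
                 suc k * (X + 1) + T₀ ≤ S
budget-exclude k {X} {T} {T₀} {c} {S} budget T₀+c≡T k<c = begin
  suc k * (X + 1) + T₀    ≡⟨ cong (_+ T₀) (*-distribˡ-+ (suc k) X 1) ⟩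
  suc k * X + suc k * 1 + T₀ ≡⟨ cong (λ m → suc k * X + m + T₀) (*-identityʳ (suc k)) ⟩
  suc k * X + suc k + T₀  ≤⟨ +-monoˡ-≤ T₀ (+-monoʳ-≤ (suc k * X) k<c) ⟩
  suc k * X + c + T₀      ≡⟨ +-assoc (suc k * X) c T₀ ⟩
  suc k * X + (c + T₀)    ≡⟨ cong (suc k * X +_) (trans (+-comm c T₀) T₀+c≡T) ⟩
  suc k * X + T           ≤⟨ budget ⟩
  S                       ∎
  where open ≤-Reasoning

budget-select : ∀ k {X T T′ S} → suc k * X + T ≤ S → T′ ≤ suc T → suc k * X + T′ ≤ S + 1
budget-select k {X} {T} {T′} {S} budget T′≤1+T = begin
  suc k * X + T′       ≤⟨ +-monoʳ-≤ (suc k * X) T′≤1+T ⟩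
  suc k * X + suc T    ≡⟨ +-suc (suc k * X) T ⟩
  suc (suc k * X + T)  ≤⟨ s≤s budget ⟩
  suc S                ≡⟨ +-comm 1 S ⟩
  S + 1                ∎
  where open ≤-Reasoning

size : ∀ {n} → (Fin n → Status) → Status → ℕ
size σ s = countIn (λ _ → true) σ s

deg : ∀ {n} → Graph n → (Fin n → Status) → Status → Fin n → ℕ
deg G σ s v = countIn (adj G v) σ s

size-pos : ∀ {n} (σ : Fin n → Status) {v s} → σ v ≡ s → 0 < size σ s
size-pos σ {v} {s} σv = ∃⇒count>0 (λ w → hasStatus σ s w ∧ true) (cong (_∧ true) (dec-true (σ v ≟ₛ s) σv))

module _ {n} (G : Graph n) (k : ℕ) where

  record Invariant (σ : Fin n → Status) (credit : Fin n → ℕ) : Set where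
    field
      decided⇒leaf     : ∀ {v} → σ v ≢ undecided → deg G σ undecided v ≤ 1
      sparse           : ∀ {v} → σ v ≡ selected → deg G σ selected v ≤ k
      saturated⇒credit : ∀ {v w} → σ v ≡ selected → deg G σ selected v ≡ k →
                         σ w ≡ undecided → adj G v w ≡ true → suc k ≤ credit w
      deg≤credit       : ∀ {w} → σ w ≡ undecided → deg G σ selected w ≤ credit w
      budget           : suc k * size σ excluded + sum credit ≤ size σ selected

  undecidedNeighbour-unique : ∀ {σ v a b} → deg G σ undecided v ≤ 1 →
                              σ a ≡ undecided → adj G v a ≡ true →
                              σ b ≡ undecided → adj G v b ≡ true → a ≡ b
  undecidedNeighbour-unique {σ} {v} ≤1 σa va σb vb =
    count≤1⇒unique (λ w → hasStatus σ undecided w ∧ adj G v w) ≤1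
      (cong₂ (λ t b → does (t ≟ₛ undecided) ∧ b) σa va) (cong₂ (λ t b → does (t ≟ₛ undecided) ∧ b) σb vb)

  transfer : (Fin n → Status) → (Fin n → ℕ) → Fin n → Fin n → ℕ
  transfer σ credit u w = zeroAt credit u w + suc (credit u) * boolToℕ (hasStatus σ undecided w ∧ adj G u w)

  module Step {σ credit u} (I : Invariant σ credit) (σu : σ u ≡ undecided) (leaf : deg G σ undecided u ≤ 1) where
    open Invariant I

    decided⇒leaf-assign : ∀ {s} → s ≢ undecided →
                          ∀ {v} → assign σ u s v ≢ undecided → deg G (assign σ u s) undecided v ≤ 1
    decided⇒leaf-assign s≢undecided {v} σ′v≢undecided with v ≟ᶠ u
    ... | yes refl = ≤-trans (countIn-assign-undecided-≤ s≢undecided (adj G u)) leaf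
      where open Assign σ u _ σu
    ... | no  v≢u  = ≤-trans (countIn-assign-undecided-≤ s≢undecided (adj G v))
                             (decided⇒leaf (σ′v≢undecided ∘ trans (assign-other v≢u)))
      where open Assign σ u _ σu

    zeroAt-other : ∀ {w} → w ≢ u → zeroAt credit u w ≡ credit w
    zeroAt-other {w} w≢u = updateAt-minimal w u credit w≢u

    module Exclude (k<credit : suc k ≤ credit u) where
      open Assign σ u excluded σu

      preserved : ∀ {v t} → assign σ u excluded v ≡ t → t ≢ excluded → σ v ≡ t × v ≢ u
      preserved = assign-preserves (λ ())

      size-excluded : size (assign σ u excluded) excluded ≡ size σ excluded + 1
      size-excluded = countIn-assign-same (λ ()) (λ _ → true)

      size-selected : size (assign σ u excluded) selected ≡ size σ selected
      size-selected = countIn-assign-other (λ ()) (λ _ → true) {t = selected} (λ ()) (λ ())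

      deg-same : ∀ {v} → deg G (assign σ u excluded) selected v ≡ deg G σ selected v
      deg-same {v} = countIn-assign-other (λ ()) (adj G v) {t = selected} (λ ()) (λ ())

      invariant : Invariant (assign σ u excluded) (zeroAt credit u)
      invariant = record
        { decided⇒leaf     = decided⇒leaf-assign (λ ())
        ; sparse           = λ σ′v → let σv , _ = preserved σ′v (λ ()) in
                               subst (_≤ k) (sym deg-same) (sparse σv)
        ; saturated⇒credit = λ σ′v d≡k σ′w vw →
                               let σv , _ = preserved σ′v (λ ()); σw , w≢u = preserved σ′w (λ ()) in
                               subst (suc k ≤_) (sym (zeroAt-other w≢u))
                                 (saturated⇒credit σv (trans (sym deg-same) d≡k) σw vw)
        ; deg≤credit       = λ σ′w → let σw , w≢u = preserved σ′w (λ ()) in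
                               subst₂ _≤_ (sym deg-same) (sym (zeroAt-other w≢u)) (deg≤credit σw)
        ; budget           = subst₂ (λ X S → suc k * X + sum (zeroAt credit u) ≤ S)
                               (sym size-excluded) (sym size-selected)
                               (budget-exclude k budget (sum-zeroAt credit u) k<credit)
        }

    transfer-other : ∀ {w} → w ≢ u → credit w ≤ transfer σ credit u w
    transfer-other {w} w≢u = subst (_≤ transfer σ credit u w) (zeroAt-other w≢u) (m≤m+n (zeroAt credit u w) _)

    transfer-neighbour : ∀ {w} → σ w ≡ undecided → adj G u w ≡ true →
                         transfer σ credit u w ≡ credit w + suc (credit u)
    transfer-neighbour {w} σw uw rewrite σw | uw =
      cong₂ _+_ (zeroAt-other (adj⇒≢ G uw ∘ sym)) (*-identityʳ (suc (credit u)))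

    sum-transfer : sum (transfer σ credit u) ≤ suc (sum credit)
    sum-transfer = begin
      sum (transfer σ credit u)               ≡⟨ ∑-distrib-+ (zeroAt credit u) (λ w → suc c * neighbour w) ⟩
      Σ₀ + sum (λ w → suc c * neighbour w)    ≡⟨ cong (Σ₀ +_) (*-distribˡ-sum (suc c) neighbour) ⟨
      Σ₀ + suc c * deg G σ undecided u        ≤⟨ +-monoʳ-≤ Σ₀ (*-monoʳ-≤ (suc c) leaf) ⟩
      Σ₀ + suc c * 1                          ≡⟨ cong (Σ₀ +_) (*-identityʳ (suc c)) ⟩
      Σ₀ + suc c                              ≡⟨ +-suc Σ₀ c ⟩
      suc (Σ₀ + c)                            ≡⟨ cong suc (sum-zeroAt credit u) ⟩
      suc (sum credit)                        ∎
      where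
      open ≤-Reasoning
      c = credit u
      Σ₀ = sum (zeroAt credit u)
      neighbour : Fin n → ℕ
      neighbour w = boolToℕ (hasStatus σ undecided w ∧ adj G u w)

    module Select (c≤k : credit u ≤ k) where
      open Assign σ u selected σu

      σ′ : Fin n → Status
      σ′ = assign σ u selected

      size-selected : size σ′ selected ≡ size σ selected + 1
      size-selected = countIn-assign-same (λ ()) (λ _ → true)

      size-excluded : size σ′ excluded ≡ size σ excluded
      size-excluded = countIn-assign-other (λ ()) (λ _ → true) {t = excluded} (λ ()) (λ ())

      deg-select : ∀ {v} → deg G σ′ selected v ≡ deg G σ selected v + boolToℕ (adj G v u)
      deg-select {v} = countIn-assign-same (λ ()) (adj G v)

      deg-select-self : deg G σ′ selected u ≡ deg G σ selected u
      deg-select-self = trans deg-select (trans (cong (λ b → deg G σ selected u + boolToℕ b) (irrefl G u)) (+-identityʳ _))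

      sparse′ : ∀ {v} → σ′ v ≡ selected → deg G σ′ selected v ≤ k
      sparse′ {v} σ′v with v ≟ᶠ u
      ... | yes refl = subst (_≤ k) (sym deg-select-self) (≤-trans (deg≤credit σu) c≤k)
      ... | no  v≢u  with σv ← trans (sym (assign-other v≢u)) σ′v rewrite deg-select {v} with adj G v u in vu
      ...   | false = subst (_≤ k) (sym (+-identityʳ _)) (sparse σv)
      ...   | true  = subst (_≤ k) (+-comm 1 _)
                        (≤∧≢⇒< (sparse σv) (λ d≡k → <⇒≱ (s≤s c≤k) (saturated⇒credit σv d≡k σu vu)))

      saturated⇒credit′ : ∀ {v w} → σ′ v ≡ selected → deg G σ′ selected v ≡ k →
                          σ′ w ≡ undecided → adj G v w ≡ true → suc k ≤ transfer σ credit u w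
      saturated⇒credit′ {v} {w} σ′v d≡k σ′w vw with σw , w≢u ← assign-preserves (λ ()) σ′w (λ ()) | v ≟ᶠ u
      ... | yes refl = begin
        suc k                      ≡⟨ cong suc (trans (sym deg-select-self) d≡k) ⟨
        suc (deg G σ selected u)   ≤⟨ s≤s (deg≤credit σu) ⟩
        suc (credit u)             ≤⟨ m≤n+m _ (credit w) ⟩
        credit w + suc (credit u)  ≡⟨ transfer-neighbour σw vw ⟨
        transfer σ credit u w      ∎
        where open ≤-Reasoning
      ... | no  v≢u  with σv ← trans (sym (assign-other v≢u)) σ′v rewrite deg-select {v} with adj G v u in vu
      ...   | true  = contradiction (undecidedNeighbour-unique (decided⇒leaf σv≢undecided) σu vu σw vw) (w≢u ∘ sym)
        where
        σv≢undecided : σ v ≢ undecided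
        σv≢undecided σv′ = contradiction (trans (sym σv) σv′) λ ()
      ...   | false = ≤-trans (saturated⇒credit σv (trans (sym (+-identityʳ _)) d≡k) σw vw) (transfer-other w≢u)

      deg≤credit′ : ∀ {w} → σ′ w ≡ undecided → deg G σ′ selected w ≤ transfer σ credit u w
      deg≤credit′ {w} σ′w with σw , w≢u ← assign-preserves (λ ()) σ′w (λ ())
                          rewrite deg-select {w} with adj G w u in wu
      ... | false = subst (_≤ transfer σ credit u w) (sym (+-identityʳ _)) (≤-trans (deg≤credit σw) (transfer-other w≢u))
      ... | true  = subst (deg G σ selected w + 1 ≤_) (sym (transfer-neighbour σw (trans (Graph.sym G u w) wu)))
                      (+-mono-≤ (deg≤credit σw) (s≤s z≤n))

      invariant : Invariant σ′ (transfer σ credit u)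
      invariant = record
        { decided⇒leaf     = decided⇒leaf-assign (λ ())
        ; sparse           = sparse′
        ; saturated⇒credit = saturated⇒credit′
        ; deg≤credit       = deg≤credit′
        ; budget           = subst₂ (λ X S → suc k * X + sum (transfer σ credit u) ≤ S)
                               (sym size-excluded) (sym size-selected)
                               (budget-select k budget sum-transfer)
        }

  initial : Invariant (λ _ → undecided) (λ _ → 0)
  initial = record
    { decided⇒leaf     = λ ≢undecided → contradiction refl ≢undecided
    ; sparse           = λ ()
    ; saturated⇒credit = λ ()
    ; deg≤credit       = λ _ → ≤-reflexive (count-false {n})
    ; budget           = subst (_≤ size {n} (λ _ → undecided) selected) (sym nothing-decided) z≤n
    }
    where
    nothing-decided : suc k * size {n} (λ _ → undecided) excluded + sum {n} (λ _ → 0) ≡ 0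
    nothing-decided = cong₂ _+_ (trans (cong (suc k *_) (count-false {n})) (*-zeroʳ (suc k))) (count-false {n})

  assign-decreases : ∀ (σ : Fin n → Status) u {s fuel} → σ u ≡ undecided → s ≢ undecided →
                     size σ undecided ≤ suc fuel → size (assign σ u s) undecided ≤ fuel
  assign-decreases σ u {s} {fuel} σu s≢undecided bound = ≤-pred (begin
    suc (size (assign σ u s) undecided)     ≡⟨ +-comm 1 _ ⟩
    size (assign σ u s) undecided + 1       ≡⟨ Assign.countIn-assign-undecided σ u s σu s≢undecided (λ _ → true) ⟩
    size σ undecided                        ≤⟨ bound ⟩
    suc fuel                                ∎)
    where open ≤-Reasoning

  undecidedLeaf : Forest G → ∀ σ {v} → σ v ≡ undecided → ∃ λ u → σ u ≡ undecided × deg G σ undecided u ≤ 1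
  undecidedLeaf forest σ {v} σv
    with u , isUndecided , leaf ← forest⇒leaf G forest (hasStatus σ undecided) (dec-true (σ v ≟ₛ undecided) σv)
    = u , ≟ₛ-true isUndecided , leaf

  greedy : Forest G → ∀ fuel σ credit → Invariant σ credit → size σ undecided ≤ fuel →
           ∃₂ λ σ′ credit′ → Invariant σ′ credit′ × (∀ v → σ′ v ≢ undecided)
  greedy forest fuel σ credit I bound with any? (λ v → σ v ≟ₛ undecided) | fuel
  ... | no  none          | _    = σ , credit , I , λ v σv → none (v , σv)
  ... | yes (v , σv)      | zero = contradiction bound (<⇒≱ (size-pos σ σv))
  ... | yes (v , σv)      | suc fuel with u , σu , leaf ← undecidedLeaf forest σ σv | credit u ≤? k
  ...   | yes c≤k = greedy forest fuel _ _ (Step.Select.invariant I σu leaf c≤k)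
                      (assign-decreases σ u σu (λ ()) bound)
  ...   | no  c≰k = greedy forest fuel _ _ (Step.Exclude.invariant I σu leaf (≰⇒> c≰k))
                      (assign-decreases σ u σu (λ ()) bound)

⌈/⌉≤ : ∀ {a b s} → a ≤ s * suc b → ⌈ a / suc b ⌉ ≤ s
⌈/⌉≤ {a} {b} {s} a≤sb = s≤s⁻¹ (subst (λ m → m / suc b < suc s) (sym (cong (_∸ 1) (+-suc a b)))
  (m<n*o⇒m/o<n (begin-strict
    a + b              <⟨ +-mono-≤-< a≤sb (n<1+n b) ⟩
    s * suc b + suc b  ≡⟨ +-comm (s * suc b) (suc b) ⟩
    suc s * suc b      ∎)))
  where open ≤-Reasoning

budget⇒bound : ∀ k {X T S n} → suc k * X + T ≤ S → S + X ≡ n → suc k * n ≤ S * suc (suc k)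
budget⇒bound k {X} {T} {S} {n} budget S+X≡n = begin
  suc k * n            ≡⟨ cong (suc k *_) S+X≡n ⟨
  suc k * (S + X)      ≡⟨ *-distribˡ-+ (suc k) S X ⟩
  suc k * S + suc k * X ≤⟨ +-monoʳ-≤ (suc k * S) (m+n≤o⇒m≤o (suc k * X) budget) ⟩
  suc k * S + S        ≡⟨ +-comm (suc k * S) S ⟩
  suc (suc k) * S      ≡⟨ *-comm (suc (suc k)) S ⟩
  S * suc (suc k)      ∎
  where open ≤-Reasoning

∈-tabulate : ∀ {n} {P : Fin n → Bool} {v} → v ∈ tabulate P → P v ≡ true
∈-tabulate {P = P} {v} v∈ = trans (sym (lookup∘tabulate P v)) ([]=⇒lookup v∈)

selectedSet : ∀ {n} → (Fin n → Status) → Subset n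
selectedSet σ = tabulate (hasStatus σ selected)

∣selectedSet∣ : ∀ {n} (σ : Fin n → Status) → ∣ selectedSet σ ∣ ≡ size σ selected
∣selectedSet∣ σ = trans (∣tabulate∣≡count (hasStatus σ selected))
                        (count-cong {Q = λ v → hasStatus σ selected v ∧ true} (λ v → sym (∧-identityʳ _)))

degIn-selectedSet : ∀ {n} (G : Graph n) σ v → degIn G (selectedSet σ) v ≡ deg G σ selected v
degIn-selectedSet G σ v = begin
  ∣ tabulate isSelected ∩ tabulate adjacent ∣        ≡⟨ cong ∣_∣ (tabulate-∩ isSelected adjacent) ⟩
  ∣ tabulate (λ w → isSelected w ∧ adjacent w) ∣    ≡⟨ ∣tabulate∣≡count (λ w → isSelected w ∧ adjacent w) ⟩
  count (λ w → isSelected w ∧ adjacent w)          ≡⟨ count-cong (λ w → cong (isSelected w ∧_) (if-true-false (adj G v w))) ⟩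
  count (λ w → isSelected w ∧ adj G v w)           ∎
  where
  open ≡-Reasoning
  isSelected = hasStatus σ selected
  adjacent   = λ w → if adj G v w then true else false
  if-true-false : ∀ b → (if b then true else false) ≡ b
  if-true-false true  = refl
  if-true-false false = refl

size-partition : ∀ {n} (σ : Fin n → Status) → (∀ v → σ v ≢ undecided) → size σ selected + size σ excluded ≡ n
size-partition {n} σ decided = begin
  sum (indicator selected) + sum (indicator excluded)  ≡⟨ ∑-distrib-+ (indicator selected) (indicator excluded) ⟨
  sum (λ v → indicator selected v + indicator excluded v) ≡⟨ sum-cong-≗ one ⟩
  count {n} (λ _ → true)                               ≡⟨ count-true ⟩
  n                                                    ∎
  where
  open ≡-Reasoning
  indicator : Status → Fin n → ℕ
  indicator s v = boolToℕ (hasStatus σ s v ∧ true)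
  one : ∀ v → indicator selected v + indicator excluded v ≡ 1
  one v with σ v | decided v
  ... | undecided | σv≢ = contradiction refl σv≢
  ... | selected  | _   = refl
  ... | excluded  | _   = refl

selectedSet-sparse : ∀ {n} (G : Graph n) k σ → (∀ {v} → σ v ≡ selected → deg G σ selected v ≤ k) →
                     Sparse k G (selectedSet σ)
selectedSet-sparse G k σ sparse v v∈S =
  subst (_≤ k) (sym (degIn-selectedSet G σ v)) (sparse (≟ₛ-true (∈-tabulate v∈S)))

lemma3p2 : (k n : ℕ) (F : Graph n) → Forest F →
    Σ (Subset n) (λ S → Sparse k F S × (⌈ (suc k * n) / suc (suc k) ⌉ ≤ ∣ S ∣))
lemma3p2 k n F forest
  with σ , credit , I , decided ← greedy F k forest n (λ _ → undecided) (λ _ → 0) (initial F k)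
                                    (≤-reflexive count-true)
  = selectedSet σ
  , selectedSet-sparse F k σ (Invariant.sparse I)
  , ⌈/⌉≤ (subst (λ S → suc k * n ≤ S * suc (suc k)) (sym (∣selectedSet∣ σ))
           (budget⇒bound k (Invariant.budget I) (size-partition σ decided)))
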